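{- Let $X$ be a set and $f:[0,1]^X\to[0,1]^X$ an MV-interior operator. Then the map $\mathcal U_f:X\to[0,1]^{[0,1]^X}$, $x\mapsto\mu_x$, where $\mu_x(\alpha)=f(\alpha)(x)$, is an MV-neighbourhood function.
   Context: $[0,1]$ has $x\oplus y=\min\{1,x+y\}$, $x\odot y=\max\{0,x+y-1\}$; operations and order on $[0,1]^X$ are pointwise. A map $f:[0,1]^X\to[0,1]^X$ is an MV-interior operator if for all $\alpha,\beta$: (I1) $f(\mathbf 1)=\mathbf 1$; (I2) $f(\alpha)\le\alpha$; (I3) $f(f(\alpha))=f(\alpha)$; (I4) $f(\alpha)\wedge f(\beta)=f(\alpha\wedge\beta)$; (I5) $f(\alpha)\oplus f(\beta)\le f(\alpha\oplus\beta)$; (I6) $f(\alpha)\odot f(\beta)\le f(\alpha\odot\beta)$. A map $\mathcal U:X\to[0,1]^{[0,1]^X}$, $x\mapsto\mu_x$, is an MV-neighbourhood function if for all $x\in X$ and $\alpha,\beta\in[0,1]^X$: (U1) $\mu_x(\mathbf 1)=1$; (U2) $\mu_x(\alpha)\le\alpha(x)$; (U3) $\mu_x(\alpha)\wedge\mu_x(\beta)=\mu_x(\alpha\wedge\beta)$; (U4) $\mu_x(\alpha)\oplus\mu_x(\beta)\le\mu_x(\alpha\oplus\beta)$; (U5) $\mu_x(\alpha)\odot\mu_x(\beta)\le\mu_x(\alpha\odot\beta)$; (U6) $\mu_x(\alpha)=\bigvee\{\mu_x(\beta):\beta\in[0,1]^X,\ \beta(y)\le\mu_y(\alpha)\ \forall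 y\in X\}$. -}

module Defs where

open import Data.Sum using (_⊎_)
open import Data.Product using (Σ; ∃; _×_; _,_; proj₁; proj₂)
open import Relation.Nullary using (¬_; yes; no)
open import Relation.Binary.PropositionalEquality using (_≡_; _≢_)
open import Relation.Binary using (Rel; Decidable)
open import Relation.Binary.Structures using (IsDecTotalOrder)
open import Algebra.Structures using (IsCommutativeRing)

-- The real numbers, axiomatised as a Dedekind-complete ordered field
-- (unique up to isomorphism).  The theorem is quantified over every
-- such structure.

record RealNumbers : Set₁ where
  infixl 6 _+_
  infixl 7 _*_
  infix  4 _≤_
  field
    ℝ    : Set
    _+_  : ℝ → ℝ → ℝ
    _*_  : ℝ → ℝ → ℝ
    -_   : ℝ → ℝ
    0ℝ   : ℝ
    1ℝ   : ℝ
    _≤_  : Rel ℝ _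
    isCommutativeRing : IsCommutativeRing _≡_ _+_ _*_ -_ 0ℝ 1ℝ
    0≢1  : 0ℝ ≢ 1ℝ
    inverse : ∀ x → x ≢ 0ℝ → Σ ℝ λ y → x * y ≡ 1ℝ
    isDecTotalOrder : IsDecTotalOrder _≡_ _≤_
    ≤-irrelevant : ∀ {x y} (p q : x ≤ y) → p ≡ q
    +-mono-≤ : ∀ {x y} z → x ≤ y → x + z ≤ y + z
    0≤1  : 0ℝ ≤ 1ℝ  -- derivable in any ordered field; stated for convenience
    *-nonneg : ∀ {x y} → 0ℝ ≤ x → 0ℝ ≤ y → 0ℝ ≤ x * y
    complete : (P : ℝ → Set) → (Σ ℝ P) → (Σ ℝ λ b → ∀ r → P r → r ≤ b) →
               Σ ℝ λ s → (∀ r → P r → r ≤ s) ×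
                         (∀ b → (∀ r → P r → r ≤ b) → s ≤ b)

  _≤?_ : Decidable _≤_
  _≤?_ = IsDecTotalOrder._≤?_ isDecTotalOrder

  total : ∀ x y → (x ≤ y) ⊎ (y ≤ x)
  total = IsDecTotalOrder.total isDecTotalOrder

module UnitInterval (R : RealNumbers) where
  open RealNumbers R
  open import Data.Sum using (inj₁; inj₂)
  open import Data.Empty using (⊥-elim)

  I : Set
  I = Σ ℝ λ r → (0ℝ ≤ r) × (r ≤ 1ℝ)

  0I 1I : I
  0I = 0ℝ , IsDecTotalOrder.refl isDecTotalOrder , 0≤1
  1I = 1ℝ , 0≤1 , IsDecTotalOrder.refl isDecTotalOrder

  private
    flip : ∀ {x y} → ¬ (x ≤ y) → y ≤ x
    flip {x} {y} ¬p with total x y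
    ... | inj₁ p = ⊥-elim (¬p p)
    ... | inj₂ q = q

  clamp : ℝ → I
  clamp r with r ≤? 0ℝ
  ... | yes _ = 0I
  ... | no r≰0 with 1ℝ ≤? r
  ...   | yes _ = 1I
  ...   | no 1≰r = r , flip r≰0 , flip 1≰r

  infixl 6 _⊕_ _⊙_
  infixr 7 _∧_
  infix  4 _≤I_

  _⊕_ : I → I → I
  x ⊕ y = clamp (proj₁ x + proj₁ y)

  _⊙_ : I → I → I
  x ⊙ y = clamp (proj₁ x + proj₁ y + - 1ℝ)

  _∧_ : I → I → I
  x ∧ y with proj₁ x ≤? proj₁ y
  ... | yes _ = x
  ... | no  _ = y

  _≤I_ : I → I → Set
  x ≤I y = proj₁ x ≤ proj₁ y

module MV (R : RealNumbers) (X : Set) where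
  open UnitInterval R public

  Fuzzy : Set
  Fuzzy = X → I

  𝟏 : Fuzzy
  𝟏 _ = 1I

  _⊕ᶠ_ _⊙ᶠ_ _∧ᶠ_ : Fuzzy → Fuzzy → Fuzzy
  (α ⊕ᶠ β) x = α x ⊕ β x
  (α ⊙ᶠ β) x = α x ⊙ β x
  (α ∧ᶠ β) x = α x ∧ β x

  _≤ᶠ_ _≈ᶠ_ : Fuzzy → Fuzzy → Set
  α ≤ᶠ β = ∀ x → α x ≤I β x
  α ≈ᶠ β = ∀ x → α x ≡ β x

  -- A map [0,1]^X → [0,1]^X (respecting equality of fuzzy sets, as any
  -- set-theoretic map does).
  record IsMVInteriorOperator (f : Fuzzy → Fuzzy) : Set where
    field
      ext : ∀ {α β} → α ≈ᶠ β → f α ≈ᶠ f β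
      I1  : f 𝟏 ≈ᶠ 𝟏
      I2  : ∀ α → f α ≤ᶠ α
      I3  : ∀ α → f (f α) ≈ᶠ f α
      I4  : ∀ α β → (f α ∧ᶠ f β) ≈ᶠ f (α ∧ᶠ β)
      I5  : ∀ α β → (f α ⊕ᶠ f β) ≤ᶠ f (α ⊕ᶠ β)
      I6  : ∀ α β → (f α ⊙ᶠ f β) ≤ᶠ f (α ⊙ᶠ β)

  record IsMVNeighbourhoodFunction (μ : X → Fuzzy → I) : Set where
    field
      U1 : ∀ x → μ x 𝟏 ≡ 1I
      U2 : ∀ x α → μ x α ≤I α x
      U3 : ∀ x α β → (μ x α ∧ μ x β) ≡ μ x (α ∧ᶠ β)
      U4 : ∀ x α β → (μ x α ⊕ μ x β) ≤I μ x (α ⊕ᶠ β)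
      U5 : ∀ x α β → (μ x α ⊙ μ x β) ≤I μ x (α ⊙ᶠ β)
      -- U6: μ x α = ⋁ { μ x β : β(y) ≤ μ y α for all y }, i.e. μ x α is
      -- the least upper bound in [0,1] of that set.
      U6-upper : ∀ x α β → (∀ y → β y ≤I μ y α) → μ x β ≤I μ x α
      U6-least : ∀ x α (u : I) →
                 (∀ β → (∀ y → β y ≤I μ y α) → μ x β ≤I u) → μ x α ≤I u

  𝒰 : (Fuzzy → Fuzzy) → X → Fuzzy → I
  𝒰 f x α = f α x

-- μ_x(α) = f(α)(x) inherits (U1)–(U5) pointwise from (I1), (I2), (I4)–(I6).
-- For (U6), the admissible β are exactly those with β ≤ f(α); since f is
-- monotone (a consequence of (I4)) and idempotent these satisfy f(β) ≤ f(f(α)) = f(α), and the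
-- bound is attained at β = f(α).
module Submission where

open import Defs
open import Data.Empty using (⊥-elim)
open import Data.Product using (proj₁)
open import Relation.Nullary using (yes; no)
open import Relation.Binary.PropositionalEquality using (_≡_; refl; subst; trans)
open import Relation.Binary.Structures using (IsDecTotalOrder)

module MeetOrder (R : RealNumbers) where
  open RealNumbers R
  open UnitInterval R

  ≤I-refl : ∀ a → a ≤I a
  ≤I-refl _ = IsDecTotalOrder.refl isDecTotalOrder

  ∧-≡ˡ : ∀ {a b} → a ≤I b → a ∧ b ≡ a
  ∧-≡ˡ {a} {b} a≤b with proj₁ a ≤? proj₁ b
  ... | yes _   = refl
  ... | no a≰b  = ⊥-elim (a≰b a≤b)

  ∧-≡ˡ⇒≤ : ∀ {a b} → a ∧ b ≡ a → a ≤I b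
  ∧-≡ˡ⇒≤ {a} {b} eq with proj₁ a ≤? proj₁ b
  ... | yes a≤b = a≤b
  ... | no _    = subst (_≤I b) eq (≤I-refl b)

module InteriorOperator (R : RealNumbers) (X : Set) {f : MV.Fuzzy R X → MV.Fuzzy R X}
                        (isInterior : MV.IsMVInteriorOperator R X f) where
  open MV R X
  open IsMVInteriorOperator isInterior
  open MeetOrder R

  mono : ∀ {α β} → α ≤ᶠ β → f α ≤ᶠ f β
  mono α≤β x = ∧-≡ˡ⇒≤ (trans (I4 _ _ x) (ext (λ y → ∧-≡ˡ (α≤β y)) x))

  ≤-interior⇒interior-≤ : ∀ {α β} → β ≤ᶠ f α → f β ≤ᶠ f α
  ≤-interior⇒interior-≤ {α} β≤fα x = subst (f _ x ≤I_) (I3 α x) (mono β≤fα x)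

proposition5p9 : (R : RealNumbers) (X : Set) (f : MV.Fuzzy R X → MV.Fuzzy R X) →
    MV.IsMVInteriorOperator R X f →
    MV.IsMVNeighbourhoodFunction R X (MV.𝒰 R X f)
proposition5p9 R X f isInterior = record
  { U1       = I1
  ; U2       = λ x α → I2 α x
  ; U3       = λ x α β → I4 α β x
  ; U4       = λ x α β → I5 α β x
  ; U5       = λ x α β → I6 α β x
  ; U6-upper = λ x α β β≤fα → ≤-interior⇒interior-≤ β≤fα x
  ; U6-least = λ x α u bound → subst (_≤I u) (I3 α x) (bound (f α) (λ y → ≤I-refl (f α y)))
  }
  where
  open MV R X
  open IsMVInteriorOperator isInterior
  open InteriorOperator R X isInterior
  open MeetOrder R
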